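{- The cluster-positive elements $M\in\mathcal{M}^{\mathrm{CP}}_{\mathbb{Z}}$ with $|\Gamma(M)|<\infty$ are exactly \[ \begin{pmatrix} 2 & 2 & 2\\ 2 & 2 & 2\end{pmatrix},\qquad \begin{pmatrix} 4 & 1 & 2\\ 1 & 4 & 2\end{pmatrix}, \] and their permutations.
   Context: $\mathcal{M}^{+}$ is the set of $2\times 3$ arrays $M=\begin{pmatrix} x & y & z\\ x' & y' & z'\end{pmatrix}$ of positive reals with $xyz=x'y'z'$. The maps are $\gamma_1(M)=\begin{pmatrix} y'z'-x & y & z\\ yz-x' & y' & z'\end{pmatrix}$, $\gamma_2(M)=\begin{pmatrix} x & z'x'-y & z\\ x' & zx-y' & z'\end{pmatrix}$, $\gamma_3(M)=\begin{pmatrix} x & y & x'y'-z\\ x' & y' & xy-z'\end{pmatrix}$; $\Gamma(M)$ is the set of images of $M$ under finite compositions $\gamma_{t_k}\cdots\gamma_{t_1}$ with $t_i\neq t_{i+1}$. $M$ is cluster-positive if every element of $\Gamma(M)$ has all entries positive; $\mathcal{M}^{\mathrm{CP}}_{\mathbb{Z}}$ is the set of cluster-positive elements with integer entries. A permutation of $M$ is obtained by permuting its columns and/or swapping its two rows. -}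

module Defs where

open import Data.Nat using (ℕ)
open import Data.Integer using (ℤ; +_; _+_; _-_; _*_; _>_)
open import Data.Fin using (Fin; zero; suc)
open import Data.Fin.Permutation using (Permutation′; _⟨$⟩ʳ_)
open import Data.Bool using (Bool; true; false)
open import Data.List using (List; []; _∷_)
open import Data.List.Relation.Unary.Linked using (Linked)
open import Data.List.Membership.Propositional using (_∈_)
open import Data.Product using (_×_; Σ; ∃; ∃-syntax)
open import Relation.Binary.PropositionalEquality using (_≡_; _≢_)

-- A 2×3 array  ( x  y  z  / x' y' z' )  with integer entries.
record Mat : Set where
  constructor mat
  field
    x y z x' y' z' : ℤ
open Mat public

InMplus : Mat → Set
InMplus (mat x y z x' y' z') =
  (x > + 0) × (y > + 0) × (z > + 0) × (x' > + 0) × (y' > + 0) × (z' > + 0)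
  × (x * y * z ≡ x' * y' * z')

AllPos : Mat → Set
AllPos (mat x y z x' y' z') =
  (x > + 0) × (y > + 0) × (z > + 0) × (x' > + 0) × (y' > + 0) × (z' > + 0)

-- the mutations γ₁, γ₂, γ₃ (indexed by Fin 3: zero ↦ γ₁, …)
γ : Fin 3 → Mat → Mat
γ zero             (mat x y z x' y' z') = mat (y' * z' - x) y z (y * z - x') y' z'
γ (suc zero)       (mat x y z x' y' z') = mat x (z' * x' - y) z x' (z * x - y') z'
γ (suc (suc zero)) (mat x y z x' y' z') = mat x y (x' * y' - z) x' y' (x * y - z')

apply : List (Fin 3) → Mat → Mat
apply []      M = M
apply (t ∷ w) M = apply w (γ t M)

Reduced : List (Fin 3) → Set
Reduced = Linked (λ a b → a ≢ b)

InΓ : Mat → Mat → Set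
InΓ M N = ∃[ w ] (Reduced w × apply w M ≡ N)

ClusterPositive : Mat → Set
ClusterPositive M = InMplus M × (∀ N → InΓ M N → AllPos N)

FiniteΓ : Mat → Set
FiniteΓ M = ∃[ L ] (∀ N → InΓ M N → N ∈ L)

entry : Mat → Fin 2 → Fin 3 → ℤ
entry M zero       zero             = x M
entry M zero       (suc zero)       = y M
entry M zero       (suc (suc zero)) = z M
entry M (suc zero) zero             = x' M
entry M (suc zero) (suc zero)       = y' M
entry M (suc zero) (suc (suc zero)) = z' M

fromEntries : (Fin 2 → Fin 3 → ℤ) → Mat
fromEntries f = mat (f zero zero) (f zero (suc zero)) (f zero (suc (suc zero)))
                    (f (suc zero) zero) (f (suc zero) (suc zero)) (f (suc zero) (suc (suc zero)))

rowSwap : Bool → Fin 2 → Fin 2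
rowSwap false i = i
rowSwap true zero = suc zero
rowSwap true (suc zero) = zero

permuteMat : Permutation′ 3 → Bool → Mat → Mat
permuteMat σ b M = fromEntries (λ i j → entry M (rowSwap b i) (σ ⟨$⟩ʳ j))

IsPermutationOf : Mat → Mat → Set
IsPermutationOf N M = ∃[ σ ] ∃[ b ] (N ≡ permuteMat σ b M)

A₁ : Mat
A₁ = mat (+ 2) (+ 2) (+ 2) (+ 2) (+ 2) (+ 2)

A₂ : Mat
A₂ = mat (+ 4) (+ 1) (+ 2) (+ 1) (+ 4) (+ 2)

-- Let M be cluster-positive with Γ(M) finite, so the top-row sums x + y + z over Γ(M) are
-- bounded. Suppose some column product, say z z', is at least 4. If γ₁ increased the top row
-- (2x < y'z'), then the identity (y'z')(z'x') = x y (z z') would force γ₂ to increase it next,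
-- then γ₁ again, and so on forever; so 2x = y'z' and 2y = z'x'. Positivity of γ₁γ₃(M), or the
-- same argument applied to the rotated matrix, then gives 2z = x'y'. Such a column product exists:
-- each column product exceeds 1 by positivity of γ₁(M) and γ₂(M), and they cannot all lie in
-- {2, 3} because their product (xyz)² is a square. The three equations make every column
-- product 4 and both row products 8, which leaves exactly the permutations of the two matrices.
-- Conversely, these matrices are fixed by every γ_t, so Γ(M) = {M}.
module Submission where

open import Data.Bool using (true; false)
open import Data.Empty using (⊥-elim)
open import Data.Fin using (Fin)
open import Data.Fin.Patterns using (0F; 1F; 2F)
open import Data.Fin.Permutation using (Permutation′; _⟨$⟩ʳ_)
import Data.Fin.Permutation as P
open import Data.Integer
  using (ℤ; +_; -[1+_]; 0ℤ; _+_; _-_; _*_; -_; _<_; _≤_; ∣_∣; +<+; +≤+; -≤+; positive; nonNegative; >-nonZero)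
import Data.Integer.Properties as ℤP
open import Algebra.Properties.CommutativeMonoid.Sum ℤP.*-1-commutativeMonoid
  using () renaming (sum to ∏; sum-permute to ∏-permute)
open import Data.Integer.Tactic.RingSolver using (solve; solve-∀)
open import Data.List using (List; []; _∷_; map)
open import Data.List.Membership.Propositional using (_∈_)
open import Data.List.Membership.Propositional.Properties using (∈-map⁺)
open import Data.List.Relation.Unary.Any using (here; there)
import Data.List.Relation.Unary.Linked as Linked
import Data.List.Relation.Unary.Linked.Properties as Linked
open import Data.Nat as ℕ using (ℕ; zero; suc; s≤s; z≤n)
import Data.Nat.Properties as ℕP
open import Data.Product using (_×_; _,_; proj₁; proj₂; ∃-syntax)
open import Data.Sum using (_⊎_; inj₁; inj₂; [_,_]′)
open import Data.Vec.Functional using (rearrange)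
open import Function using (_∘_)
open import Function.Bundles using (_⇔_; mk⇔)
open import Relation.Binary.PropositionalEquality
  using (_≡_; _≢_; refl; sym; trans; cong; cong₂; subst; module ≡-Reasoning)
open import Relation.Nullary using (¬_; yes; no)

open import Defs

private
  variable
    a b c i j k u v w : ℤ

-- Integer arithmetic

0<2 : 0ℤ < + 2
0<2 = ℤP.positive⁻¹ (+ 2)

*-pos : 0ℤ < a → 0ℤ < b → 0ℤ < a * b
*-pos {a} {b} 0<a 0<b = subst (_< a * b) (ℤP.*-zeroʳ a) (ℤP.*-monoˡ-<-pos a {{positive 0<a}} 0<b)

*-cancelˡ-pos-< : 0ℤ < a → a * b < a * c → b < c
*-cancelˡ-pos-< {a} 0<a = ℤP.*-cancelˡ-<-nonNeg a {{nonNegative (ℤP.<⇒≤ 0<a)}}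

*-cancelˡ-pos-≡ : 0ℤ < a → a * b ≡ a * c → b ≡ c
*-cancelˡ-pos-≡ {a} {b} {c} 0<a = ℤP.*-cancelˡ-≡ a b c {{>-nonZero 0<a}}

i≤i*j : 0ℤ < i → 0ℤ < j → i ≤ i * j
i≤i*j {i} {j} 0<i 0<j = begin
  i        ≡⟨ ℤP.*-identityʳ i ⟨
  i * + 1  ≤⟨ ℤP.*-monoˡ-≤-nonNeg i {{nonNegative (ℤP.<⇒≤ 0<i)}} (ℤP.i<j⇒suc[i]≤j 0<j) ⟩
  i * j    ∎
  where open ℤP.≤-Reasoning

<⇒0<- : a < b → 0ℤ < b - a
<⇒0<- {a} {b} a<b = subst (_< b - a) (ℤP.+-inverseʳ a) (ℤP.+-monoˡ-< (- a) a<b)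

0<-⇒< : 0ℤ < b - a → a < b
0<-⇒< {b} {a} 0<b-a = begin-strict
  a          ≡⟨ ℤP.+-identityˡ a ⟨
  0ℤ + a     <⟨ ℤP.+-monoˡ-< a 0<b-a ⟩
  b - a + a  ≡⟨ solve (a ∷ b ∷ []) ⟩
  b          ∎
  where open ℤP.≤-Reasoning

i<i+j : 0ℤ < j → i < i + j
i<i+j {j} {i} 0<j = subst (_< i + j) (ℤP.+-identityʳ i) (ℤP.+-monoʳ-< i 0<j)

i+j≰j : 0ℤ < i → ¬ (i + j ≤ j)
i+j≰j {i} {j} 0<i = ℤP.<⇒≱ (subst (_< i + j) (ℤP.+-identityˡ j) (ℤP.+-monoˡ-< j 0<i))

<⇒+suc≤ : ∀ {n} → i < j → j + + n ≤ k → i + + suc n ≤ k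
<⇒+suc≤ {i} {j} {k} {n} i<j j+n≤k = begin
  i + + suc n      ≡⟨ cong (λ q → i + q) (ℤP.pos-+ 1 n) ⟩
  i + (+ 1 + + n)  ≡⟨ ℤP.+-assoc i (+ 1) (+ n) ⟨
  i + + 1 + + n    ≡⟨ cong (λ q → q + + n) (ℤP.+-comm i (+ 1)) ⟩
  + 1 + i + + n    ≤⟨ ℤP.+-monoˡ-≤ (+ n) (ℤP.i<j⇒suc[i]≤j i<j) ⟩
  j + + n          ≤⟨ j+n≤k ⟩
  k                ∎
  where open ℤP.≤-Reasoning

i≤+∣i∣ : ∀ i → i ≤ + ∣ i ∣
i≤+∣i∣ (+ n)    = ℤP.≤-refl
i≤+∣i∣ -[1+ n ] = -≤+

*-rotate : ∀ a b c → a * b * c ≡ b * c * a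
*-rotate = solve-∀

+-rotate : ∀ a b c → a + b + c ≡ b + c + a
+-rotate = solve-∀

*-rotations : a * b * c ≡ k → (a * (b * c) ≡ k) × (b * (c * a) ≡ k) × (c * (a * b) ≡ k)
*-rotations {a} {b} {c} abc≡k =
    trans (sym (ℤP.*-assoc a b c)) abc≡k
  , trans (sym (ℤP.*-assoc b c a)) (trans (sym (*-rotate a b c)) abc≡k)
  , trans (sym (ℤP.*-assoc c a b)) (trans (*-rotate c a b) abc≡k)

-- The mutation a ↦ b - a reflects a across b/2.
mutation-reflects : + 2 * a < b → b < + 2 * (b - a)
mutation-reflects {a} {b} 2a<b = begin-strict
  b                  <⟨ i<i+j (<⇒0<- 2a<b) ⟩
  b + (b - + 2 * a)  ≡⟨ solve (a ∷ b ∷ []) ⟩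
  + 2 * (b - a)      ∎
  where open ℤP.≤-Reasoning

seesaw : 0ℤ < a → 0ℤ < b → 0ℤ < u → + 4 ≤ c → u * v ≡ a * b * c → u < + 2 * a → + 2 * b < v
seesaw {a} {b} {u} {c} {v} 0<a 0<b 0<u 4≤c uv≡abc u<2a = *-cancelˡ-pos-< 0<u (begin-strict
  u * (+ 2 * b)        <⟨ ℤP.*-monoʳ-<-pos (+ 2 * b) {{positive (*-pos 0<2 0<b)}} u<2a ⟩
  + 2 * a * (+ 2 * b)  ≡⟨ solve (a ∷ b ∷ []) ⟩
  a * b * + 4          ≤⟨ ℤP.*-monoˡ-≤-nonNeg (a * b) {{nonNegative (ℤP.<⇒≤ (*-pos 0<a 0<b))}} 4≤c ⟩
  a * b * c            ≡⟨ uv≡abc ⟨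
  u * v                ∎)
  where open ℤP.≤-Reasoning

ℕ-square-between : ∀ m {k} n → m ℕ.* m ℕ.< k → k ℕ.< suc m ℕ.* suc m → n ℕ.* n ≢ k
ℕ-square-between m n m²<k k<[1+m]² refl with n ℕP.≤? m
... | yes n≤m = ℕP.<-irrefl refl (ℕP.≤-<-trans (ℕP.*-mono-≤ n≤m n≤m) m²<k)
... | no  n≰m = ℕP.<-irrefl refl (ℕP.<-≤-trans k<[1+m]² (ℕP.*-mono-≤ (ℕP.≰⇒> n≰m) (ℕP.≰⇒> n≰m)))

square-between : ∀ m {k} P → m ℕ.* m ℕ.< k → k ℕ.< suc m ℕ.* suc m → P * P ≢ + k
square-between m P m²<k k<[1+m]² P²≡k =
  ℕ-square-between m ∣ P ∣ m²<k k<[1+m]² (trans (sym (ℤP.abs-* P P)) (cong ∣_∣ P²≡k))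

data TwoOrThree : ℤ → Set where
  two   : TwoOrThree (+ 2)
  three : TwoOrThree (+ 3)

two-or-three : + 1 < k → k < + 4 → TwoOrThree k
two-or-three {+ 2} _ _ = two
two-or-three {+ 3} _ _ = three
two-or-three {+ 0} (+<+ ()) _
two-or-three {+ 1} (+<+ (s≤s ())) _
two-or-three {+ suc (suc (suc (suc n)))} _ (+<+ (s≤s (s≤s (s≤s (s≤s ())))))
two-or-three { -[1+ n ]} () _

product-not-square : ∀ P → TwoOrThree u → TwoOrThree v → TwoOrThree w → P * P ≢ u * v * w
product-not-square P two   two   two   = square-between 2 P (ℕP.m≤m+n 5 3) ℕP.≤-refl
product-not-square P two   two   three = square-between 3 P (ℕP.m≤m+n 10 2) (ℕP.m≤m+n 13 3)
product-not-square P two   three two   = square-between 3 P (ℕP.m≤m+n 10 2) (ℕP.m≤m+n 13 3)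
product-not-square P three two   two   = square-between 3 P (ℕP.m≤m+n 10 2) (ℕP.m≤m+n 13 3)
product-not-square P two   three three = square-between 4 P (ℕP.m≤m+n 17 1) (ℕP.m≤m+n 19 6)
product-not-square P three two   three = square-between 4 P (ℕP.m≤m+n 17 1) (ℕP.m≤m+n 19 6)
product-not-square P three three two   = square-between 4 P (ℕP.m≤m+n 17 1) (ℕP.m≤m+n 19 6)
product-not-square P three three three = square-between 5 P (ℕP.m≤m+n 26 1) (ℕP.m≤m+n 28 8)

data Factors4 : ℤ → ℤ → Set where
  1·4 : Factors4 (+ 1) (+ 4)
  2·2 : Factors4 (+ 2) (+ 2)
  4·1 : Factors4 (+ 4) (+ 1)

4<5+n : ∀ {n} → + 4 < + suc (suc (suc (suc (suc n))))
4<5+n = +<+ (s≤s (s≤s (s≤s (s≤s (s≤s z≤n)))))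

factorise-4 : 0ℤ < u → 0ℤ < v → u * v ≡ + 4 → Factors4 u v
factorise-4 {+ 1} {v} _ _ uv≡4 = subst (Factors4 (+ 1)) (trans (sym uv≡4) (ℤP.*-identityˡ v)) 1·4
factorise-4 {+ 2} {v} _ _ uv≡4 = subst (Factors4 (+ 2)) (sym (*-cancelˡ-pos-≡ 0<2 uv≡4)) 2·2
factorise-4 {+ 4} {v} 0<4 _ uv≡4 = subst (Factors4 (+ 4)) (sym (*-cancelˡ-pos-≡ 0<4 uv≡4)) 4·1
factorise-4 {+ 3} {+ 1} _ _ ()
factorise-4 {+ 3} {+ 2} _ _ ()
factorise-4 {+ 3} {+ 3} _ _ ()
factorise-4 {+ 3} {+ 4} _ _ ()
factorise-4 {+ 3} {v@(+ suc (suc (suc (suc (suc _)))))} 0<3 0<v 3v≡4 =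
  ⊥-elim (ℤP.<⇒≱ 4<5+n (subst (v ≤_) (trans (ℤP.*-comm v (+ 3)) 3v≡4) (i≤i*j 0<v 0<3)))
factorise-4 {u@(+ suc (suc (suc (suc (suc _)))))} 0<u 0<v uv≡4 =
  ⊥-elim (ℤP.<⇒≱ 4<5+n (subst (u ≤_) uv≡4 (i≤i*j 0<u 0<v)))
factorise-4 {+ 0} (+<+ ())
factorise-4 { -[1+ _ ]} ()

bounded : ∀ (L : List ℤ) → ∃[ B ] (∀ {i} → i ∈ L → i ≤ + B)
bounded []      = 0 , λ ()
bounded (i ∷ L) = ∣ i ∣ ℕ.+ proj₁ (bounded L) , λ where
  (here refl) → ℤP.≤-trans (i≤+∣i∣ i) (+≤+ (ℕP.m≤m+n ∣ i ∣ _))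
  (there j∈L) → ℤP.≤-trans (proj₂ (bounded L) j∈L) (+≤+ (ℕP.m≤n+m _ ∣ i ∣))

-- Matrices and the orbit Γ

RowProductsAgree : Mat → Set
RowProductsAgree (mat x y z x' y' z') = x * y * z ≡ x' * y' * z'

inMplus : ∀ {N} → AllPos N → RowProductsAgree N → InMplus N
inMplus (0<x , 0<y , 0<z , 0<x' , 0<y' , 0<z') e = 0<x , 0<y , 0<z , 0<x' , 0<y' , 0<z' , e

γ-preserves-RowProductsAgree : ∀ t N → RowProductsAgree N → RowProductsAgree (γ t N)
γ-preserves-RowProductsAgree 0F (mat x y z x' y' z') e = begin
  (y' * z' - x) * y * z             ≡⟨ solve (x ∷ y ∷ z ∷ y' ∷ z' ∷ []) ⟩
  y * z * (y' * z') - x * y * z     ≡⟨ cong (λ q → y * z * (y' * z') - q) e ⟩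
  y * z * (y' * z') - x' * y' * z'  ≡⟨ solve (y ∷ z ∷ x' ∷ y' ∷ z' ∷ []) ⟩
  (y * z - x') * y' * z'            ∎
  where open ≡-Reasoning
γ-preserves-RowProductsAgree 1F (mat x y z x' y' z') e = begin
  x * (z' * x' - y) * z             ≡⟨ solve (x ∷ y ∷ z ∷ x' ∷ z' ∷ []) ⟩
  z * x * (z' * x') - x * y * z     ≡⟨ cong (λ q → z * x * (z' * x') - q) e ⟩
  z * x * (z' * x') - x' * y' * z'  ≡⟨ solve (x ∷ z ∷ x' ∷ y' ∷ z' ∷ []) ⟩
  x' * (z * x - y') * z'            ∎
  where open ≡-Reasoning
γ-preserves-RowProductsAgree 2F (mat x y z x' y' z') e = begin
  x * y * (x' * y' - z)             ≡⟨ solve (x ∷ y ∷ z ∷ x' ∷ y' ∷ []) ⟩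
  x * y * (x' * y') - x * y * z     ≡⟨ cong (λ q → x * y * (x' * y') - q) e ⟩
  x * y * (x' * y') - x' * y' * z'  ≡⟨ solve (x ∷ y ∷ x' ∷ y' ∷ z' ∷ []) ⟩
  x' * y' * (x * y - z')            ∎
  where open ≡-Reasoning

apply-preserves-RowProductsAgree : ∀ w N → RowProductsAgree N → RowProductsAgree (apply w N)
apply-preserves-RowProductsAgree []      N e = e
apply-preserves-RowProductsAgree (t ∷ w) N e =
  apply-preserves-RowProductsAgree w (γ t N) (γ-preserves-RowProductsAgree t N e)

apply-fixed : ∀ {M} → (∀ t → γ t M ≡ M) → ∀ w → apply w M ≡ M
apply-fixed fixed []      = refl
apply-fixed fixed (t ∷ w) rewrite fixed t = apply-fixed fixed w

rowSum : Mat → ℤ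
rowSum N = x N + y N + z N

rowSum-pos : ∀ {N} → InMplus N → 0ℤ < rowSum N
rowSum-pos (0<x , 0<y , 0<z , _) = ℤP.+-mono-< (ℤP.+-mono-< 0<x 0<y) 0<z

AllΓ : (Mat → Set) → Mat → Set
AllΓ P N = ∀ w → Reduced w → P (apply w N)

Confined : ℕ → Mat → Set
Confined B N = InMplus N × rowSum N ≤ + B

self-InMplus : ∀ {B N} → AllΓ (Confined B) N → InMplus N
self-InMplus all = proj₁ (all [] Linked.[])

clusterPositive-finite⇒confined : ∀ {M} → ClusterPositive M → FiniteΓ M → ∃[ B ] AllΓ (Confined B) M
clusterPositive-finite⇒confined {M} ((_ , _ , _ , _ , _ , _ , e) , positive) (L , Γ⊆L) =
  proj₁ (bounded (map rowSum L)) , λ w r →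
    inMplus (positive _ (w , r , refl)) (apply-preserves-RowProductsAgree w M e)
  , proj₂ (bounded (map rowSum L)) (∈-map⁺ rowSum (Γ⊆L _ (w , r , refl)))

-- Rotating the columns

ρ : Mat → Mat
ρ (mat x y z x' y' z') = mat y z x y' z' x'

next : Fin 3 → Fin 3
next 0F = 1F
next 1F = 2F
next 2F = 0F

prev : Fin 3 → Fin 3
prev 0F = 2F
prev 1F = 0F
prev 2F = 1F

prev-next : ∀ t → prev (next t) ≡ t
prev-next 0F = refl
prev-next 1F = refl
prev-next 2F = refl

next-injective : ∀ {s t} → next s ≡ next t → s ≡ t
next-injective {s} {t} e = trans (sym (prev-next s)) (trans (cong prev e) (prev-next t))

γ-ρ : ∀ t N → γ t (ρ N) ≡ ρ (γ (next t) N)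
γ-ρ 0F N = refl
γ-ρ 1F N = refl
γ-ρ 2F N = refl

apply-ρ : ∀ w N → apply w (ρ N) ≡ ρ (apply (map next w) N)
apply-ρ []      N = refl
apply-ρ (t ∷ w) N rewrite γ-ρ t N = apply-ρ w (γ (next t) N)

AllΓ-ρ : ∀ {P N} → (∀ {K} → P K → P (ρ K)) → AllΓ P N → AllΓ P (ρ N)
AllΓ-ρ {P} {N} P-ρ all w r = subst P (sym (apply-ρ w N))
  (P-ρ (all (map next w) (Linked.map⁺ (Linked.map (λ s≢t → s≢t ∘ next-injective) r))))

Confined-ρ : ∀ {B K} → Confined B K → Confined B (ρ K)
Confined-ρ {K = mat x y z x' y' z'} ((0<x , 0<y , 0<z , 0<x' , 0<y' , 0<z' , e) , bound) =
    (0<y , 0<z , 0<x , 0<y' , 0<z' , 0<x' , trans (sym (*-rotate x y z)) (trans e (*-rotate x' y' z')))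
  , subst (_≤ _) (+-rotate x y z) bound

AllΓ-Confined-ρ : ∀ {B N} → AllΓ (Confined B) N → AllΓ (Confined B) (ρ N)
AllΓ-Confined-ρ {B} = AllΓ-ρ (λ {K} → Confined-ρ {B} {K})

-- Climbing along alternating mutations

rowSum-γ₁ : ∀ {N} → + 2 * x N < y' N * z' N → rowSum N < rowSum (γ 0F N)
rowSum-γ₁ {mat x y z x' y' z'} 2x<y'z' = begin-strict
  x + y + z                        <⟨ i<i+j (<⇒0<- 2x<y'z') ⟩
  x + y + z + (y' * z' - + 2 * x)  ≡⟨ solve (x ∷ y ∷ z ∷ y' ∷ z' ∷ []) ⟩
  y' * z' - x + y + z              ∎
  where open ℤP.≤-Reasoning

rowSum-γ₂ : ∀ {N} → + 2 * y N < z' N * x' N → rowSum N < rowSum (γ 1F N)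
rowSum-γ₂ {mat x y z x' y' z'} 2y<z'x' = begin-strict
  x + y + z                        <⟨ i<i+j (<⇒0<- 2y<z'x') ⟩
  x + y + z + (z' * x' - + 2 * y)  ≡⟨ solve (x ∷ y ∷ z ∷ x' ∷ z' ∷ []) ⟩
  x + (z' * x' - y) + z            ∎
  where open ℤP.≤-Reasoning

seesaw₁₂ : ∀ {N} → InMplus N → + 4 ≤ z N * z' N → y' N * z' N < + 2 * x N → + 2 * y N < z' N * x' N
seesaw₁₂ {mat x y z x' y' z'} (0<x , 0<y , _ , _ , 0<y' , 0<z' , e) 4≤zz' =
  seesaw 0<x 0<y (*-pos 0<y' 0<z') 4≤zz' (begin
    y' * z' * (z' * x')  ≡⟨ solve (x' ∷ y' ∷ z' ∷ []) ⟩
    z' * (x' * y' * z')  ≡⟨ cong (z' *_) e ⟨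
    z' * (x * y * z)     ≡⟨ solve (x ∷ y ∷ z ∷ z' ∷ []) ⟩
    x * y * (z * z')     ∎)
  where open ≡-Reasoning

seesaw₂₁ : ∀ {N} → InMplus N → + 4 ≤ z N * z' N → z' N * x' N < + 2 * y N → + 2 * x N < y' N * z' N
seesaw₂₁ {mat x y z x' y' z'} (0<x , 0<y , _ , 0<x' , _ , 0<z' , e) 4≤zz' =
  seesaw 0<y 0<x (*-pos 0<z' 0<x') 4≤zz' (begin
    z' * x' * (y' * z')  ≡⟨ solve (x' ∷ y' ∷ z' ∷ []) ⟩
    z' * (x' * y' * z')  ≡⟨ cong (z' *_) e ⟨
    z' * (x * y * z)     ≡⟨ solve (x ∷ y ∷ z ∷ z' ∷ []) ⟩
    y * x * (z * z')     ∎)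
  where open ≡-Reasoning

alternating : Fin 3 → Fin 3 → ℕ → List (Fin 3)
alternating s t zero    = []
alternating s t (suc n) = s ∷ alternating t s n

alternating-reduced : ∀ {s t} n → s ≢ t → Reduced (alternating s t n)
alternating-reduced zero          _   = Linked.[]
alternating-reduced (suc zero)    _   = Linked.[-]
alternating-reduced (suc (suc n)) s≢t = s≢t Linked.∷ alternating-reduced (suc n) (s≢t ∘ sym)

mutual
  climb₁₂ : ∀ n N → (∀ m → InMplus (apply (alternating 0F 1F m) N)) → + 4 ≤ z N * z' N →
            + 2 * x N < y' N * z' N → rowSum N + + n ≤ rowSum (apply (alternating 0F 1F n) N)
  climb₁₂ zero    N _    _     _    = ℤP.≤-reflexive (ℤP.+-identityʳ (rowSum N))
  climb₁₂ (suc n) N path 4≤zz' grow = <⇒+suc≤ (rowSum-γ₁ {N} grow)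
    (climb₂₁ n (γ 0F N) (path ∘ suc) 4≤zz' (seesaw₁₂ (path 1) 4≤zz' (mutation-reflects grow)))

  climb₂₁ : ∀ n N → (∀ m → InMplus (apply (alternating 1F 0F m) N)) → + 4 ≤ z N * z' N →
            + 2 * y N < z' N * x' N → rowSum N + + n ≤ rowSum (apply (alternating 1F 0F n) N)
  climb₂₁ zero    N _    _     _    = ℤP.≤-reflexive (ℤP.+-identityʳ (rowSum N))
  climb₂₁ (suc n) N path 4≤zz' grow = <⇒+suc≤ (rowSum-γ₂ {N} grow)
    (climb₁₂ n (γ 1F N) (path ∘ suc) 4≤zz' (seesaw₂₁ (path 1) 4≤zz' (mutation-reflects grow)))

no-climb₁₂ : ∀ {B N} → AllΓ (Confined B) N → + 4 ≤ z N * z' N → ¬ (+ 2 * x N < y' N * z' N)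
no-climb₁₂ {B} {N} all 4≤zz' grow = i+j≰j (rowSum-pos (self-InMplus all))
  (ℤP.≤-trans (climb₁₂ B N (proj₁ ∘ along) 4≤zz' grow) (proj₂ (along B)))
  where
  along : ∀ m → Confined B (apply (alternating 0F 1F m) N)
  along m = all _ (alternating-reduced m (λ ()))

no-climb₂₁ : ∀ {B N} → AllΓ (Confined B) N → + 4 ≤ z N * z' N → ¬ (+ 2 * y N < z' N * x' N)
no-climb₂₁ {B} {N} all 4≤zz' grow = i+j≰j (rowSum-pos (self-InMplus all))
  (ℤP.≤-trans (climb₂₁ B N (proj₁ ∘ along) 4≤zz' grow) (proj₂ (along B)))
  where
  along : ∀ m → Confined B (apply (alternating 1F 0F m) N)
  along m = all _ (alternating-reduced m (λ ()))

-- Stability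

-- Each top-row entry is fixed by its own mutation: y'z' - x = x, and so on.
Stable : Mat → Set
Stable (mat x y z x' y' z') = (+ 2 * x ≡ y' * z') × (+ 2 * y ≡ z' * x') × (+ 2 * z ≡ x' * y')

unrotate : ∀ {N} → Stable (ρ N) → Stable N
unrotate (2y≡z'x' , 2z≡x'y' , 2x≡y'z') = 2x≡y'z' , 2y≡z'x' , 2z≡x'y'

stable-xy : ∀ {B N} → AllΓ (Confined B) N → + 4 ≤ z N * z' N →
            (+ 2 * x N ≡ y' N * z' N) × (+ 2 * y N ≡ z' N * x' N)
stable-xy all 4≤zz' =
    ℤP.≤-antisym (ℤP.≮⇒≥ (no-climb₂₁ all 4≤zz' ∘ seesaw₁₂ M⁺ 4≤zz'))
                 (ℤP.≮⇒≥ (no-climb₁₂ all 4≤zz'))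
  , ℤP.≤-antisym (ℤP.≮⇒≥ (no-climb₁₂ all 4≤zz' ∘ seesaw₂₁ M⁺ 4≤zz'))
                 (ℤP.≮⇒≥ (no-climb₂₁ all 4≤zz'))
  where M⁺ = self-InMplus all

4<xx' : ∀ {N} → InMplus N → + 2 * y N ≡ z' N * x' N → + 2 * z N < x' N * y' N → + 4 < x N * x' N
4<xx' {mat x y z x' y' z'} (_ , 0<y , 0<z , _ , _ , _ , e) 2y≡z'x' 2z<x'y' =
  *-cancelˡ-pos-< (*-pos 0<y 0<z) (begin-strict
    y * z * + 4          ≡⟨ solve (y ∷ z ∷ []) ⟩
    + 2 * y * (+ 2 * z)  <⟨ ℤP.*-monoˡ-<-pos (+ 2 * y) {{positive (*-pos 0<2 0<y)}} 2z<x'y' ⟩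
    + 2 * y * (x' * y')  ≡⟨ cong (λ q → q * (x' * y')) 2y≡z'x' ⟩
    z' * x' * (x' * y')  ≡⟨ solve (x' ∷ y' ∷ z' ∷ []) ⟩
    x' * (x' * y' * z')  ≡⟨ cong (x' *_) e ⟨
    x' * (x * y * z)     ≡⟨ solve (x ∷ y ∷ z ∷ x' ∷ []) ⟩
    y * z * (x * x')     ∎)
  where open ℤP.≤-Reasoning

zz'≡4 : ∀ {N} → InMplus N → + 2 * x N ≡ y' N * z' N → + 2 * y N ≡ z' N * x' N → z N * z' N ≡ + 4
zz'≡4 {mat x y z x' y' z'} (0<x , 0<y , _ , _ , _ , _ , e) 2x≡y'z' 2y≡z'x' =
  *-cancelˡ-pos-≡ (*-pos 0<x 0<y) (begin
    x * y * (z * z')     ≡⟨ solve (x ∷ y ∷ z ∷ z' ∷ []) ⟩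
    z' * (x * y * z)     ≡⟨ cong (z' *_) e ⟩
    z' * (x' * y' * z')  ≡⟨ solve (x' ∷ y' ∷ z' ∷ []) ⟩
    y' * z' * (z' * x')  ≡⟨ cong₂ _*_ 2x≡y'z' 2y≡z'x' ⟨
    + 2 * x * (+ 2 * y)  ≡⟨ solve (x ∷ y ∷ []) ⟩
    x * y * + 4          ∎)
  where open ≡-Reasoning

yy'<zz' : ∀ {x' y y' z z'} → 0ℤ < z' → + 2 * y ≡ z' * x' → x' * y' < + 2 * z → y * y' < z * z'
yy'<zz' {x'} {y} {y'} {z} {z'} 0<z' 2y≡z'x' x'y'<2z = *-cancelˡ-pos-< 0<2 (begin-strict
  + 2 * (y * y')  ≡⟨ solve (y ∷ y' ∷ []) ⟩
  y' * (+ 2 * y)  ≡⟨ cong (y' *_) 2y≡z'x' ⟩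
  y' * (z' * x')  ≡⟨ solve (x' ∷ y' ∷ z' ∷ []) ⟩
  z' * (x' * y')  <⟨ ℤP.*-monoˡ-<-pos z' {{positive 0<z'}} x'y'<2z ⟩
  z' * (+ 2 * z)  ≡⟨ solve (z ∷ z' ∷ []) ⟩
  + 2 * (z * z')  ∎)
  where open ℤP.≤-Reasoning

3<yy' : ∀ {x y y' z'} → 0ℤ < x → + 2 * x ≡ y' * z' → 0ℤ < y' * (x * y - z') - x → + 3 < y * y'
3<yy' {x} {y} {y'} {z'} 0<x 2x≡y'z' 0<γ₁γ₃ = *-cancelˡ-pos-< 0<x (begin-strict
  x * + 3                             <⟨ i<i+j 0<γ₁γ₃ ⟩
  x * + 3 + (y' * (x * y - z') - x)   ≡⟨ solve (x ∷ y ∷ y' ∷ z' ∷ []) ⟩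
  x * (y * y') + (+ 2 * x - y' * z')  ≡⟨ cong (λ q → x * (y * y') + (q - y' * z')) 2x≡y'z' ⟩
  x * (y * y') + (y' * z' - y' * z')  ≡⟨ solve (x ∷ y ∷ y' ∷ z' ∷ []) ⟩
  x * (y * y')                        ∎)
  where open ℤP.≤-Reasoning

-- 2z < x'y' makes x x' > 4, and then the rotated matrix, whose third column is (x, x'),
-- forces 2z = x'y'.
undershoot : ∀ {B N} → AllΓ (Confined B) N → + 4 ≤ z N * z' N → ¬ (+ 2 * z N < x' N * y' N)
undershoot {N = N} all 4≤zz' 2z<x'y' =
  ℤP.<-irrefl (proj₂ (stable-xy {N = ρ N} (AllΓ-Confined-ρ all) 4≤xx')) 2z<x'y'
  where
  4≤xx' = ℤP.<⇒≤ (4<xx' {N} (self-InMplus all) (proj₂ (stable-xy all 4≤zz')) 2z<x'y')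

-- x'y' < 2z would make the first entry of γ₁(γ₃ N) non-positive.
overshoot : ∀ {B N} → AllΓ (Confined B) N → + 4 ≤ z N * z' N → ¬ (x' N * y' N < + 2 * z N)
overshoot {B} {N} all 4≤zz' x'y'<2z = ℤP.<⇒≱ yy'<4 4≤yy'
  where
  M⁺ = self-InMplus all
  2x≡y'z' = proj₁ (stable-xy all 4≤zz')
  2y≡z'x' = proj₂ (stable-xy all 4≤zz')
  0<z' = proj₁ (proj₂ (proj₂ (proj₂ (proj₂ (proj₂ M⁺)))))
  0<γ₁γ₃ = proj₁ (proj₁ (all (2F ∷ 0F ∷ []) ((λ ()) Linked.∷ Linked.[-])))
  yy'<4 = subst (y N * y' N <_) (zz'≡4 {N} M⁺ 2x≡y'z' 2y≡z'x')
                (yy'<zz' {x' N} {y N} {y' N} {z N} 0<z' 2y≡z'x' x'y'<2z)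
  4≤yy' = ℤP.i<j⇒suc[i]≤j (3<yy' {x N} {y N} {y' N} {z' N} (proj₁ M⁺) 2x≡y'z' 0<γ₁γ₃)

large-zz'⇒stable : ∀ {B N} → AllΓ (Confined B) N → + 4 ≤ z N * z' N → Stable N
large-zz'⇒stable all 4≤zz' =
  proj₁ (stable-xy all 4≤zz') , proj₂ (stable-xy all 4≤zz') ,
  ℤP.≤-antisym (ℤP.≮⇒≥ (overshoot all 4≤zz')) (ℤP.≮⇒≥ (undershoot all 4≤zz'))

1<zz' : ∀ {N} → InMplus N → InMplus (γ 0F N) → InMplus (γ 1F N) → + 1 < z N * z' N
1<zz' {mat x y z x' y' z'} (0<x , 0<y , _ , _ , 0<y' , 0<z' , e) (0<y'z'-x , _) (_ , 0<z'x'-y , _) =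
  *-cancelˡ-pos-< (*-pos 0<x 0<y) (begin-strict
    x * y * + 1          ≡⟨ ℤP.*-identityʳ (x * y) ⟩
    x * y                <⟨ ℤP.*-monoʳ-<-pos y {{positive 0<y}} (0<-⇒< {y' * z'} {x} 0<y'z'-x) ⟩
    y' * z' * y          <⟨ ℤP.*-monoˡ-<-pos (y' * z') {{positive (*-pos 0<y' 0<z')}}
                                             (0<-⇒< {z' * x'} {y} 0<z'x'-y) ⟩
    y' * z' * (z' * x')  ≡⟨ solve (x' ∷ y' ∷ z' ∷ []) ⟩
    z' * (x' * y' * z')  ≡⟨ cong (z' *_) e ⟨
    z' * (x * y * z)     ≡⟨ solve (x ∷ y ∷ z ∷ z' ∷ []) ⟩
    x * y * (z * z')     ∎)
  where open ℤP.≤-Reasoning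

row-product-squared : ∀ {N} → InMplus N →
  x N * y N * z N * (x N * y N * z N) ≡ x N * x' N * (y N * y' N) * (z N * z' N)
row-product-squared {mat x y z x' y' z'} (_ , _ , _ , _ , _ , _ , e) = begin
  x * y * z * (x * y * z)       ≡⟨ cong (x * y * z *_) e ⟩
  x * y * z * (x' * y' * z')    ≡⟨ solve (x ∷ y ∷ z ∷ x' ∷ y' ∷ z' ∷ []) ⟩
  x * x' * (y * y') * (z * z')  ∎
  where open ≡-Reasoning

some-column-product-large : ∀ {N} → InMplus N →
  + 1 < x N * x' N → + 1 < y N * y' N → + 1 < z N * z' N →
  + 4 ≤ z N * z' N ⊎ + 4 ≤ x N * x' N ⊎ + 4 ≤ y N * y' N
some-column-product-large {N} M⁺ 1<xx' 1<yy' 1<zz'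
  with + 4 ℤP.≤? z N * z' N | + 4 ℤP.≤? x N * x' N | + 4 ℤP.≤? y N * y' N
... | yes 4≤zz' | _         | _         = inj₁ 4≤zz'
... | no _      | yes 4≤xx' | _         = inj₂ (inj₁ 4≤xx')
... | no _      | no _      | yes 4≤yy' = inj₂ (inj₂ 4≤yy')
... | no 4≰zz'  | no 4≰xx'  | no 4≰yy'  = ⊥-elim (product-not-square (x N * y N * z N)
      (two-or-three 1<xx' (ℤP.≰⇒> 4≰xx')) (two-or-three 1<yy' (ℤP.≰⇒> 4≰yy'))
      (two-or-three 1<zz' (ℤP.≰⇒> 4≰zz')) (row-product-squared {N} M⁺))

confined⇒stable : ∀ {B N} → AllΓ (Confined B) N → Stable N
confined⇒stable {B} {N} all =
  [ large-zz'⇒stable all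
  , [ unrotate {N} ∘ large-zz'⇒stable all₁
    , unrotate {N} ∘ unrotate {ρ N} ∘ large-zz'⇒stable all₂ ]′ ]′
  (some-column-product-large {N} (self-InMplus all) (1<zz'-in all₁) (1<zz'-in all₂) (1<zz'-in all))
  where
  all₁ = AllΓ-Confined-ρ all
  all₂ = AllΓ-Confined-ρ all₁
  1<zz'-in : ∀ {K} → AllΓ (Confined B) K → + 1 < z K * z' K
  1<zz'-in {K} all = 1<zz' {K} (self-InMplus all)
    (proj₁ (all (0F ∷ []) Linked.[-])) (proj₁ (all (1F ∷ []) Linked.[-]))

-- Balanced matrices

Balanced : Mat → Set
Balanced (mat x y z x' y' z') =
  (x * x' ≡ + 4) × (y * y' ≡ + 4) × (z * z' ≡ + 4) × (x * y * z ≡ + 8) × (x' * y' * z' ≡ + 8)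

column-product≡4 : + 2 * u ≡ w → v * w ≡ + 8 → u * v ≡ + 4
column-product≡4 {u} {w} {v} 2u≡w vw≡8 = *-cancelˡ-pos-≡ 0<2 (begin
  + 2 * (u * v)  ≡⟨ solve (u ∷ v ∷ []) ⟩
  v * (+ 2 * u)  ≡⟨ cong (v *_) 2u≡w ⟩
  v * w          ≡⟨ vw≡8 ⟩
  + 2 * + 4      ∎)
  where open ≡-Reasoning

stable⇒balanced : ∀ {N} → InMplus N → Stable N → Balanced N
stable⇒balanced {mat x y z x' y' z'} (0<x , 0<y , 0<z , _ , _ , _ , e) (2x≡y'z' , 2y≡z'x' , 2z≡x'y') =
    column-product≡4 2x≡y'z' (proj₁ bottom)
  , column-product≡4 2y≡z'x' (proj₁ (proj₂ bottom))
  , column-product≡4 2z≡x'y' (proj₂ (proj₂ bottom))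
  , xyz≡8
  , trans (sym e) xyz≡8
  where
  open ≡-Reasoning
  xyz≡8 : x * y * z ≡ + 8
  xyz≡8 = *-cancelˡ-pos-≡ (*-pos (*-pos 0<x 0<y) 0<z) (begin
    x * y * z * (x * y * z)          ≡⟨ cong₂ _*_ e e ⟩
    x' * y' * z' * (x' * y' * z')    ≡⟨ solve (x' ∷ y' ∷ z' ∷ []) ⟩
    y' * z' * (z' * x') * (x' * y')  ≡⟨ cong₂ _*_ (cong₂ _*_ 2x≡y'z' 2y≡z'x') 2z≡x'y' ⟨
    + 2 * x * (+ 2 * y) * (+ 2 * z)  ≡⟨ solve (x ∷ y ∷ z ∷ []) ⟩
    x * y * z * + 8                  ∎)
  bottom = *-rotations {x'} {y'} {z'} (trans (sym e) xyz≡8)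

classify : ∀ {x y z x' y' z'} → Factors4 x x' → Factors4 y y' → Factors4 z z' → x * y * z ≡ + 8 →
           IsPermutationOf (mat x y z x' y' z') A₁ ⊎ IsPermutationOf (mat x y z x' y' z') A₂
classify 1·4 1·4 1·4 ()
classify 1·4 1·4 2·2 ()
classify 1·4 1·4 4·1 ()
classify 1·4 2·2 1·4 ()
classify 1·4 2·2 2·2 ()
classify 1·4 2·2 4·1 _  = inj₂ (P.transpose 1F 2F , true , refl)
classify 1·4 4·1 1·4 ()
classify 1·4 4·1 2·2 _  = inj₂ (P.id , true , refl)
classify 1·4 4·1 4·1 ()
classify 2·2 1·4 1·4 ()
classify 2·2 1·4 2·2 ()
classify 2·2 1·4 4·1 _  = inj₂ (P.transpose 0F 2F , false , refl)
classify 2·2 2·2 1·4 ()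
classify 2·2 2·2 2·2 _  = inj₁ (P.id , false , refl)
classify 2·2 2·2 4·1 ()
classify 2·2 4·1 1·4 _  = inj₂ (P.transpose 0F 2F , true , refl)
classify 2·2 4·1 2·2 ()
classify 2·2 4·1 4·1 ()
classify 4·1 1·4 1·4 ()
classify 4·1 1·4 2·2 _  = inj₂ (P.id , false , refl)
classify 4·1 1·4 4·1 ()
classify 4·1 2·2 1·4 _  = inj₂ (P.transpose 1F 2F , false , refl)
classify 4·1 2·2 2·2 ()
classify 4·1 2·2 4·1 ()
classify 4·1 4·1 1·4 ()
classify 4·1 4·1 2·2 ()
classify 4·1 4·1 4·1 ()

balanced⇒permutation : ∀ {N} → InMplus N → Balanced N → IsPermutationOf N A₁ ⊎ IsPermutationOf N A₂
balanced⇒permutation (0<x , 0<y , 0<z , 0<x' , 0<y' , 0<z' , _) (xx'≡4 , yy'≡4 , zz'≡4 , xyz≡8 , _) =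
  classify (factorise-4 0<x 0<x' xx'≡4) (factorise-4 0<y 0<y' yy'≡4) (factorise-4 0<z 0<z' zz'≡4) xyz≡8

mutation-fixes-entry : 0ℤ < v → u * v ≡ + 4 → v * w ≡ + 8 → w - u ≡ u
mutation-fixes-entry {v} {u} {w} 0<v uv≡4 vw≡8 = *-cancelˡ-pos-≡ 0<v (begin
  v * (w - u)    ≡⟨ solve (u ∷ v ∷ w ∷ []) ⟩
  v * w - u * v  ≡⟨ cong₂ _-_ vw≡8 uv≡4 ⟩
  + 4            ≡⟨ uv≡4 ⟨
  u * v          ≡⟨ ℤP.*-comm u v ⟩
  v * u          ∎)
  where open ≡-Reasoning

balanced⇒γ-fixed : ∀ {M} → AllPos M → Balanced M → ∀ t → γ t M ≡ M
balanced⇒γ-fixed {mat x y z x' y' z'} (0<x , 0<y , 0<z , 0<x' , 0<y' , 0<z')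
                 (xx'≡4 , yy'≡4 , zz'≡4 , xyz≡8 , x'y'z'≡8) = λ where
    0F → cong₂ (λ a a' → mat a y z a' y' z')
           (mutation-fixes-entry 0<x' xx'≡4 (proj₁ bottom))
           (mutation-fixes-entry 0<x (trans (ℤP.*-comm x' x) xx'≡4) (proj₁ top))
    1F → cong₂ (λ b b' → mat x b z x' b' z')
           (mutation-fixes-entry 0<y' yy'≡4 (proj₁ (proj₂ bottom)))
           (mutation-fixes-entry 0<y (trans (ℤP.*-comm y' y) yy'≡4) (proj₁ (proj₂ top)))
    2F → cong₂ (λ c c' → mat x y c x' y' c')
           (mutation-fixes-entry 0<z' zz'≡4 (proj₂ (proj₂ bottom)))
           (mutation-fixes-entry 0<z (trans (ℤP.*-comm z' z) zz'≡4) (proj₂ (proj₂ top)))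
  where
  top = *-rotations {x} {y} {z} xyz≡8
  bottom = *-rotations {x'} {y'} {z'} x'y'z'≡8

balanced⇒clusterPositive-finite : ∀ {M} → AllPos M → Balanced M → ClusterPositive M × FiniteΓ M
balanced⇒clusterPositive-finite {M} M⁺ bal@(_ , _ , _ , xyz≡8 , x'y'z'≡8) =
    (inMplus M⁺ (trans xyz≡8 (sym x'y'z'≡8)) , λ { N (w , _ , refl) → subst AllPos (sym (stays w)) M⁺ })
  , (M ∷ [] , λ { N (w , _ , refl) → here (stays w) })
  where
  stays = apply-fixed (balanced⇒γ-fixed M⁺ bal)

-- Permuting rows and columns

positive-entries : ∀ {M} → AllPos M → ∀ i j → 0ℤ < entry M i j
positive-entries (0<x , _ , _ , _ , _ , _) 0F 0F = 0<x
positive-entries (_ , 0<y , _ , _ , _ , _) 0F 1F = 0<y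
positive-entries (_ , _ , 0<z , _ , _ , _) 0F 2F = 0<z
positive-entries (_ , _ , _ , 0<x' , _ , _) 1F 0F = 0<x'
positive-entries (_ , _ , _ , _ , 0<y' , _) 1F 1F = 0<y'
positive-entries (_ , _ , _ , _ , _ , 0<z') 1F 2F = 0<z'

permute-AllPos : ∀ σ b {M} → AllPos M → AllPos (permuteMat σ b M)
permute-AllPos σ b M⁺ = pos 0F 0F , pos 0F 1F , pos 0F 2F , pos 1F 0F , pos 1F 1F , pos 1F 2F
  where pos = λ i j → positive-entries M⁺ (rowSwap b i) (σ ⟨$⟩ʳ j)

column-products : ∀ {M} → Balanced M → ∀ j → entry M 0F j * entry M 1F j ≡ + 4
column-products (xx'≡4 , _ , _ , _ , _) 0F = xx'≡4
column-products (_ , yy'≡4 , _ , _ , _) 1F = yy'≡4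
column-products (_ , _ , zz'≡4 , _ , _) 2F = zz'≡4

row-products : ∀ {M} → Balanced M → ∀ i → entry M i 0F * entry M i 1F * entry M i 2F ≡ + 8
row-products (_ , _ , _ , xyz≡8 , _)    0F = xyz≡8
row-products (_ , _ , _ , _ , x'y'z'≡8) 1F = x'y'z'≡8

rowSwap-product : ∀ b (f : Fin 2 → ℤ) → f (rowSwap b 0F) * f (rowSwap b 1F) ≡ f 0F * f 1F
rowSwap-product false f = refl
rowSwap-product true  f = ℤP.*-comm (f 1F) (f 0F)

∏₃ : ∀ (f : Fin 3 → ℤ) → ∏ f ≡ f 0F * f 1F * f 2F
∏₃ f = unit-assoc (f 0F) (f 1F) (f 2F)
  where
  unit-assoc : ∀ a b c → a * (b * (c * + 1)) ≡ a * b * c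
  unit-assoc = solve-∀

permute-product : ∀ (f : Fin 3 → ℤ) (σ : Permutation′ 3) →
                  f (σ ⟨$⟩ʳ 0F) * f (σ ⟨$⟩ʳ 1F) * f (σ ⟨$⟩ʳ 2F) ≡ f 0F * f 1F * f 2F
permute-product f σ = begin
  f (σ ⟨$⟩ʳ 0F) * f (σ ⟨$⟩ʳ 1F) * f (σ ⟨$⟩ʳ 2F)  ≡⟨ ∏₃ (rearrange (σ ⟨$⟩ʳ_) f) ⟨
  ∏ (rearrange (σ ⟨$⟩ʳ_) f)                      ≡⟨ ∏-permute f σ ⟨
  ∏ f                                            ≡⟨ ∏₃ f ⟩
  f 0F * f 1F * f 2F                             ∎
  where open ≡-Reasoning

permute-Balanced : ∀ σ b {M} → Balanced M → Balanced (permuteMat σ b M)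
permute-Balanced σ b {M} bal = column 0F , column 1F , column 2F , row 0F , row 1F
  where
  column = λ j → trans (rowSwap-product b (λ i → entry M i (σ ⟨$⟩ʳ j))) (column-products bal (σ ⟨$⟩ʳ j))
  row = λ i → trans (permute-product (entry M (rowSwap b i)) σ) (row-products bal (rowSwap b i))

permutation⇒clusterPositive-finite : ∀ {M A} → AllPos A → Balanced A → IsPermutationOf M A →
                                     ClusterPositive M × FiniteΓ M
permutation⇒clusterPositive-finite A⁺ bal (σ , b , refl) =
  balanced⇒clusterPositive-finite (permute-AllPos σ b A⁺) (permute-Balanced σ b bal)

A₁-AllPos : AllPos A₁
A₁-AllPos = 0<2 , 0<2 , 0<2 , 0<2 , 0<2 , 0<2

A₂-AllPos : AllPos A₂
A₂-AllPos = ℤP.positive⁻¹ _ , ℤP.positive⁻¹ _ , 0<2 , ℤP.positive⁻¹ _ , ℤP.positive⁻¹ _ , 0<2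

proposition9p11 : (M : Mat) →
    (ClusterPositive M × FiniteΓ M) ⇔ (IsPermutationOf M A₁ ⊎ IsPermutationOf M A₂)
proposition9p11 M = mk⇔ forward backward
  where
  forward : ClusterPositive M × FiniteΓ M → IsPermutationOf M A₁ ⊎ IsPermutationOf M A₂
  forward (cp@(M⁺ , _) , finite) = balanced⇒permutation M⁺
    (stable⇒balanced M⁺ (confined⇒stable (proj₂ (clusterPositive-finite⇒confined cp finite))))

  backward : IsPermutationOf M A₁ ⊎ IsPermutationOf M A₂ → ClusterPositive M × FiniteΓ M
  backward (inj₁ perm) = permutation⇒clusterPositive-finite A₁-AllPos (refl , refl , refl , refl , refl) perm
  backward (inj₂ perm) = permutation⇒clusterPositive-finite A₂-AllPos (refl , refl , refl , refl , refl) perm
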